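{- Let $D\ne 1$ be a squarefree integer and $K=\mathbb{Q}(\sqrt{D})$. Then the lattice $\Lambda_D:=\Lambda_K=\sigma(\mathcal{O}_K)\subset\mathbb{R}^2$ is WR if and only if $D=-1$ or $D=-3$.
   Context: $\mathcal{O}_K=\mathbb{Z}[\sqrt{D}]$ if $D\not\equiv 1\pmod 4$ and $\mathcal{O}_K=\mathbb{Z}[\frac{1+\sqrt{D}}{2}]$ if $D\equiv 1\pmod 4$. The embedding $\sigma:K\to\mathbb{R}^2$ is: if $D>1$ (real quadratic), $\sigma(x)=(\sigma_1(x),\sigma_2(x))$ where $\sigma_1,\sigma_2$ are the two real embeddings ($\sqrt{D}\mapsto\sqrt{D}$ and $\sqrt{D}\mapsto-\sqrt{D}$); if $D<0$ (imaginary quadratic), $\sigma(x)=(\Re\tau(x),\Im\tau(x))$ for a fixed complex embedding $\tau$. A full-rank lattice $\Lambda\subset\mathbb{R}^2$ is well-rounded (WR) if its set of minimal vectors $S(\Lambda)=\{x\in\Lambda:\|x\|^2=\min_{y\in\Lambda\setminus\{0\}}\|y\|^2\}$ (Euclidean norm) spans $\mathbb{R}^2$. -}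

module Defs where

open import Data.Bool using (Bool; true; false; if_then_else_)
open import Data.Nat as ℕ using (ℕ)
open import Data.Nat.Divisibility as ℕD using ()
open import Data.Integer as ℤ using (ℤ; +_; _+_; _-_; _*_; -_; ∣_∣; _≤_; _%_)
open import Data.Integer.Properties using (_<?_)
open import Data.Product using (_×_; _,_; proj₁; proj₂; ∃; ∃-syntax)
open import Relation.Nullary using (¬_; does)
open import Relation.Binary.PropositionalEquality using (_≡_)

-- D is squarefree: the only natural number whose square divides D is 1.
-- (D = 0 is not squarefree since every n*n divides 0.)
Squarefree : ℤ → Set
Squarefree D = ∀ (n : ℕ) → (n ℕ.* n) ℕD.∣ ∣ D ∣ → n ≡ 1

oneMod4 : ℤ → Bool
oneMod4 D = (D % + 4) ℕ.≡ᵇ 1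

isReal : ℤ → Bool
isReal D = does (+ 0 <? D)

-- An element of O_K is written with integer coordinates (a , b) w.r.t. the
-- Z-basis {1, ω}, where ω = (1+√D)/2 if D ≡ 1 (mod 4) and ω = √D otherwise.
OK : Set
OK = ℤ × ℤ

-- x = a + b ω  =  (p + q √D) / 2   with integers p, q:
--   D ≡ 1 mod 4 : p = 2a + b , q = b
--   otherwise   : p = 2a     , q = 2b
halfCoords : ℤ → OK → ℤ × ℤ
halfCoords D (a , b) =
  if oneMod4 D then (+ 2 * a + b , b) else (+ 2 * a , + 2 * b)

-- 4 · ‖σ(x)‖²  (Euclidean norm of the Minkowski embedding σ, scaled by 4
-- so that it is an integer):
--  real case, σ(x) = ((p+q√D)/2 , (p-q√D)/2):     ‖σ x‖² = (p² + D q²)/2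
--  imaginary case, σ(x) = (p/2 , q√|D|/2):         ‖σ x‖² = (p² - D q²)/4
normSq4 : ℤ → OK → ℤ
normSq4 D x with halfCoords D x
... | (p , q) = if isReal D then + 2 * (p * p + D * (q * q))
                            else p * p - D * (q * q)

nonzero : OK → Set
nonzero (a , b) = ¬ ((a , b) ≡ (+ 0 , + 0))

-- x is a minimal vector of Λ_D = σ(O_K):  σ(x) ≠ 0 and ‖σ x‖² ≤ ‖σ y‖²
-- for every nonzero y (σ is injective, so σ(x) ≠ 0 ⇔ x ≠ 0).
Minimal : ℤ → OK → Set
Minimal D x = nonzero x × (∀ y → nonzero y → normSq4 D x ≤ normSq4 D y)

-- The minimal vectors span ℝ²: there are two minimal vectors σ(x), σ(y)
-- that are linearly independent. Since σ(1), σ(ω) is an ℝ-basis of ℝ²,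
-- this is equivalent to (a₁,b₁), (a₂,b₂) being independent, i.e. a₁b₂ - a₂b₁ ≠ 0.
WellRounded : ℤ → Set
WellRounded D = ∃[ x ] ∃[ y ] (Minimal D x × Minimal D y ×
  ¬ (proj₁ x * proj₂ y - proj₁ y * proj₂ x ≡ + 0))

{-# OPTIONS --safe #-}
-- Writing x = (p + q√D)/2, the scaled squared norm of σ(x) is s (p² + |D| q²) with
-- s = 2 for real and s = 1 for imaginary D; the vector 1 has (p , q) = (2 , 0), so norm 4s.
-- If x = a + bω with b ≠ 0 then q = b (D ≡ 1 mod 4) or q = 2b, and |D| ≥ 5 resp. |D| ≥ 2
-- unless D ∈ {1, -3} resp. D ∈ {0, -1}; so x is strictly longer than 1. Outside
-- D ∈ {-1, -3} all minimal vectors are thus integer multiples of 1 and cannot span,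
-- while for D = -1 and D = -3 both 1 and ω attain the minimum 4.
module Submission where

open import Defs
open import Data.Integer using (ℤ; +_; -_)
open import Data.Sum using (_⊎_)
open import Data.Product using (_×_)
open import Relation.Nullary using (¬_)
open import Relation.Binary.PropositionalEquality using (_≡_)

import Data.Integer.Properties as ℤ
open import Algebra.Properties.AbelianGroup ℤ.+-0-abelianGroup using (inverseʳ-unique)
open import Data.Bool using (true; false; if_then_else_)
open import Data.Integer using (-[1+_]; ∣_∣; _+_; _-_; _*_; _≤_; _<_; +≤+; +<+)
open import Data.Nat as ℕ using (ℕ; zero; suc; z≤n; s≤s; NonZero)
import Data.Nat.Divisibility as ℕ
import Data.Nat.Properties as ℕ
open import Data.Product using (_,_; proj₁; proj₂)
open import Data.Sum using (inj₁; inj₂)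
open import Function using (_∘_)
open import Relation.Nullary using (yes; no; contradiction)
open import Relation.Binary.PropositionalEquality
  using (_≢_; refl; sym; trans; cong; cong₂; subst; module ≡-Reasoning)
open ≡-Reasoning

i*i≡+∣i∣*∣i∣ : ∀ i → i * i ≡ + (∣ i ∣ ℕ.* ∣ i ∣)
i*i≡+∣i∣*∣i∣ (+ n)    = sym (ℤ.pos-* n n)
i*i≡+∣i∣*∣i∣ -[1+ n ] = refl

1≤∣i∣ : ∀ {i} → i ≢ + 0 → 1 ℕ.≤ ∣ i ∣
1≤∣i∣ i≢0 = ℕ.n≢0⇒n>0 (i≢0 ∘ ℤ.∣i∣≡0⇒i≡0)

2≤∣2*i∣ : ∀ {i} → i ≢ + 0 → 2 ℕ.≤ ∣ + 2 * i ∣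
2≤∣2*i∣ {i} i≢0 rewrite ℤ.abs-* (+ 2) i = ℕ.*-monoʳ-≤ 2 (1≤∣i∣ i≢0)

square-mono-≤ : ∀ {m n} → m ℕ.≤ n → m ℕ.* m ℕ.≤ n ℕ.* n
square-mono-≤ m≤n = ℕ.*-mono-≤ m≤n m≤n

quadForm : ℕ → ℤ × ℤ → ℕ
quadForm d (p , q) = ∣ p ∣ ℕ.* ∣ p ∣ ℕ.+ d ℕ.* (∣ q ∣ ℕ.* ∣ q ∣)

scale : ℤ → ℕ
scale D = if isReal D then 2 else 1

scale-nonZero : ∀ D → NonZero (scale D)
scale-nonZero D with isReal D
... | true  = _
... | false = _

i*i+d*j*j≡quadForm : ∀ d i j → i * i + + d * (j * j) ≡ + quadForm d (i , j)
i*i+d*j*j≡quadForm d i j = begin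
  i * i + + d * (j * j)
    ≡⟨ cong₂ (λ x y → x + + d * y) (i*i≡+∣i∣*∣i∣ i) (i*i≡+∣i∣*∣i∣ j) ⟩
  + (∣ i ∣ ℕ.* ∣ i ∣) + + d * + (∣ j ∣ ℕ.* ∣ j ∣)
    ≡⟨ cong (λ t → + (∣ i ∣ ℕ.* ∣ i ∣) + t) (sym (ℤ.pos-* d _)) ⟩
  + (∣ i ∣ ℕ.* ∣ i ∣) + + (d ℕ.* (∣ j ∣ ℕ.* ∣ j ∣))
    ≡⟨ sym (ℤ.pos-+ (∣ i ∣ ℕ.* ∣ i ∣) _) ⟩
  + quadForm d (i , j) ∎

i*i-D*j*j≡quadForm : ∀ D i j → - D ≡ + ∣ D ∣ →
                     i * i - D * (j * j) ≡ + quadForm ∣ D ∣ (i , j)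
i*i-D*j*j≡quadForm D i j -D≡∣D∣ = begin
  i * i + - (D * (j * j)) ≡⟨ cong (_+_ (i * i)) (ℤ.neg-distribˡ-* D _) ⟩
  i * i + - D * (j * j)   ≡⟨ cong (λ c → i * i + c * (j * j)) -D≡∣D∣ ⟩
  i * i + + ∣ D ∣ * (j * j) ≡⟨ i*i+d*j*j≡quadForm ∣ D ∣ i j ⟩
  + quadForm ∣ D ∣ (i , j) ∎

normSq4≡scale*quadForm : ∀ D x → normSq4 D x ≡ + (scale D ℕ.* quadForm ∣ D ∣ (halfCoords D x))
-- For D = 0 the parity test oneMod4 computes, so halfCoords is already a pair.
normSq4≡scale*quadForm (+ zero) (a , b) =
  trans (i*i-D*j*j≡quadForm (+ 0) (+ 2 * a) (+ 2 * b) refl) (cong +_ (sym (ℕ.*-identityˡ _)))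
normSq4≡scale*quadForm (+ suc d) x with halfCoords (+ suc d) x
... | (p , q) = trans (cong (_*_ (+ 2)) (i*i+d*j*j≡quadForm (suc d) p q))
                      (sym (ℤ.pos-* 2 (quadForm (suc d) (p , q))))
normSq4≡scale*quadForm -[1+ n ] x with halfCoords -[1+ n ] x
... | (p , q) = trans (i*i-D*j*j≡quadForm -[1+ n ] p q refl)
                      (cong +_ (sym (ℕ.*-identityˡ _)))

halfCoords-1 : ∀ D → halfCoords D (+ 1 , + 0) ≡ (+ 2 , + 0)
halfCoords-1 D with oneMod4 D
... | true  = refl
... | false = refl

normSq4-1 : ∀ D → normSq4 D (+ 1 , + 0) ≡ + (scale D ℕ.* 4)
normSq4-1 D = begin
  normSq4 D (+ 1 , + 0)
    ≡⟨ normSq4≡scale*quadForm D (+ 1 , + 0) ⟩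
  + (scale D ℕ.* quadForm ∣ D ∣ (halfCoords D (+ 1 , + 0)))
    ≡⟨ cong (λ x → + (scale D ℕ.* quadForm ∣ D ∣ x)) (halfCoords-1 D) ⟩
  + (scale D ℕ.* (4 ℕ.+ ∣ D ∣ ℕ.* 0))
    ≡⟨ cong (λ n → + (scale D ℕ.* (4 ℕ.+ n))) (ℕ.*-zeroʳ ∣ D ∣) ⟩
  + (scale D ℕ.* 4) ∎

quadForm-lowerBoundˡ : ∀ d x → ∣ proj₁ x ∣ ℕ.* ∣ proj₁ x ∣ ℕ.≤ quadForm d x
quadForm-lowerBoundˡ d (p , q) = ℕ.m≤m+n _ _

quadForm-lowerBoundʳ : ∀ d x → d ℕ.* (∣ proj₂ x ∣ ℕ.* ∣ proj₂ x ∣) ℕ.≤ quadForm d x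
quadForm-lowerBoundʳ d (p , q) = ℕ.m≤n+m _ _

normSq4-lowerBound : ∀ D m → (∀ y → nonzero y → m ℕ.≤ quadForm ∣ D ∣ (halfCoords D y)) →
                     ∀ y → nonzero y → + m ≤ normSq4 D y
normSq4-lowerBound D m bound y y≢0 rewrite normSq4≡scale*quadForm D y =
  +≤+ (ℕ.≤-trans (bound y y≢0) (ℕ.m≤n*m _ (scale D) {{scale-nonZero D}}))

oneMod4⇒5≤∣D∣ : ∀ D → oneMod4 D ≡ true → D ≢ + 1 → D ≢ - + 3 → 5 ℕ.≤ ∣ D ∣
oneMod4⇒5≤∣D∣ (+ 1) _ D≢1 _ = contradiction refl D≢1
oneMod4⇒5≤∣D∣ (+ suc (suc (suc (suc (suc _))))) _ _ _ = s≤s (s≤s (s≤s (s≤s (s≤s z≤n))))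
oneMod4⇒5≤∣D∣ -[1+ 2 ] _ _ D≢-3 = contradiction refl D≢-3
oneMod4⇒5≤∣D∣ -[1+ suc (suc (suc (suc _))) ] _ _ _ = s≤s (s≤s (s≤s (s≤s (s≤s z≤n))))
oneMod4⇒5≤∣D∣ (+ 0) ()
oneMod4⇒5≤∣D∣ (+ 2) ()
oneMod4⇒5≤∣D∣ (+ 3) ()
oneMod4⇒5≤∣D∣ (+ 4) ()
oneMod4⇒5≤∣D∣ -[1+ 0 ] ()
oneMod4⇒5≤∣D∣ -[1+ 1 ] ()
oneMod4⇒5≤∣D∣ -[1+ 3 ] ()

¬oneMod4⇒2≤∣D∣ : ∀ D → oneMod4 D ≡ false → D ≢ + 0 → D ≢ - + 1 → 2 ℕ.≤ ∣ D ∣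
¬oneMod4⇒2≤∣D∣ (+ 0) _ D≢0 _ = contradiction refl D≢0
¬oneMod4⇒2≤∣D∣ (+ 1) ()
¬oneMod4⇒2≤∣D∣ (+ suc (suc _)) _ _ _ = s≤s (s≤s z≤n)
¬oneMod4⇒2≤∣D∣ -[1+ 0 ] _ _ D≢-1 = contradiction refl D≢-1
¬oneMod4⇒2≤∣D∣ -[1+ suc _ ] _ _ _ = s≤s (s≤s z≤n)

4<∣D∣*∣q∣² : ∀ D a b → D ≢ + 0 → D ≢ + 1 → D ≢ - + 1 → D ≢ - + 3 → b ≢ + 0 →
             let q = proj₂ (halfCoords D (a , b)) in 4 ℕ.< ∣ D ∣ ℕ.* (∣ q ∣ ℕ.* ∣ q ∣)
4<∣D∣*∣q∣² D a b D≢0 D≢1 D≢-1 D≢-3 b≢0 with oneMod4 D in eq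
... | true  = ℕ.*-mono-≤ (oneMod4⇒5≤∣D∣ D eq D≢1 D≢-3) (square-mono-≤ (1≤∣i∣ b≢0))
... | false = ℕ.≤-trans (ℕ.m≤m+n 5 3)
                (ℕ.*-mono-≤ (¬oneMod4⇒2≤∣D∣ D eq D≢0 D≢-1) (square-mono-≤ (2≤∣2*i∣ b≢0)))

normSq4-1<normSq4 : ∀ D a b → D ≢ + 0 → D ≢ + 1 → D ≢ - + 1 → D ≢ - + 3 → b ≢ + 0 →
                    normSq4 D (+ 1 , + 0) < normSq4 D (a , b)
normSq4-1<normSq4 D a b D≢0 D≢1 D≢-1 D≢-3 b≢0
  rewrite normSq4-1 D | normSq4≡scale*quadForm D (a , b) =
  +<+ (ℕ.*-monoʳ-< (scale D) {{scale-nonZero D}}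
    (ℕ.<-≤-trans (4<∣D∣*∣q∣² D a b D≢0 D≢1 D≢-1 D≢-3 b≢0)
                 (quadForm-lowerBoundʳ ∣ D ∣ (halfCoords D (a , b)))))

minimal⇒snd≡0 : ∀ D → D ≢ + 0 → D ≢ + 1 → D ≢ - + 1 → D ≢ - + 3 →
                ∀ {x} → Minimal D x → proj₂ x ≡ + 0
minimal⇒snd≡0 D D≢0 D≢1 D≢-1 D≢-3 {a , b} (_ , minimal) with b ℤ.≟ + 0
... | yes b≡0 = b≡0
... | no  b≢0 = contradiction (minimal (+ 1 , + 0) λ ())
                  (ℤ.<⇒≱ (normSq4-1<normSq4 D a b D≢0 D≢1 D≢-1 D≢-3 b≢0))

squarefree⇒≢0 : ∀ {D} → Squarefree D → D ≢ + 0
squarefree⇒≢0 sf refl with sf 2 (4 ℕ.∣0)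
... | ()

wellRounded⇒≡-1⊎≡-3 : ∀ D → D ≢ + 0 → D ≢ + 1 → WellRounded D → D ≡ - + 1 ⊎ D ≡ - + 3
wellRounded⇒≡-1⊎≡-3 D D≢0 D≢1 ((a₁ , b₁) , (a₂ , b₂) , x-min , y-min , det≢0)
  with D ℤ.≟ - + 1 | D ℤ.≟ - + 3
... | yes D≡-1 | _         = inj₁ D≡-1
... | no _     | yes D≡-3  = inj₂ D≡-3
... | no D≢-1  | no D≢-3   = contradiction
  (det≡0 (minimal⇒snd≡0 D D≢0 D≢1 D≢-1 D≢-3 x-min) (minimal⇒snd≡0 D D≢0 D≢1 D≢-1 D≢-3 y-min))
  det≢0
  where
  det≡0 : b₁ ≡ + 0 → b₂ ≡ + 0 → a₁ * b₂ - a₂ * b₁ ≡ + 0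
  det≡0 refl refl rewrite ℤ.*-zeroʳ a₁ | ℤ.*-zeroʳ a₂ = refl

wellRounded-if-1-ω-shortest : ∀ D m → (∀ y → nonzero y → m ≤ normSq4 D y) →
                              normSq4 D (+ 1 , + 0) ≡ m → normSq4 D (+ 0 , + 1) ≡ m → WellRounded D
wellRounded-if-1-ω-shortest D m shortest ∣1∣≡m ∣ω∣≡m =
  (+ 1 , + 0) , (+ 0 , + 1) ,
  ((λ ()) , λ y y≢0 → subst (_≤ normSq4 D y) (sym ∣1∣≡m) (shortest y y≢0)) ,
  ((λ ()) , λ y y≢0 → subst (_≤ normSq4 D y) (sym ∣ω∣≡m) (shortest y y≢0)) ,
  λ ()

4≤quadForm-gaussian : ∀ y → nonzero y → 4 ℕ.≤ quadForm 1 (halfCoords (- + 1) y)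
4≤quadForm-gaussian (a , b) y≢0 with a ℤ.≟ + 0
... | no a≢0   = ℕ.≤-trans (square-mono-≤ (2≤∣2*i∣ a≢0)) (quadForm-lowerBoundˡ 1 (+ 2 * a , + 2 * b))
... | yes refl = ℕ.≤-trans (square-mono-≤ (2≤∣2*i∣ b≢0))
                   (ℕ.≤-trans (ℕ.m≤n*m _ 1) (quadForm-lowerBoundʳ 1 (+ 0 , + 2 * b)))
  where
  b≢0 : b ≢ + 0
  b≢0 refl = y≢0 refl

4≤quadForm-eisenstein : ∀ y → nonzero y → 4 ℕ.≤ quadForm 3 (halfCoords (- + 3) y)
4≤quadForm-eisenstein (a , b) y≢0 with b ℤ.≟ + 0 | + 2 * a + b ℤ.≟ + 0
... | yes refl | _ = ℕ.≤-trans (square-mono-≤ 2≤∣2a+0∣) (quadForm-lowerBoundˡ 3 (+ 2 * a + + 0 , + 0))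
  where
  a≢0 : a ≢ + 0
  a≢0 refl = y≢0 refl
  2≤∣2a+0∣ : 2 ℕ.≤ ∣ + 2 * a + + 0 ∣
  2≤∣2a+0∣ = subst (λ p → 2 ℕ.≤ ∣ p ∣) (sym (ℤ.+-identityʳ (+ 2 * a))) (2≤∣2*i∣ a≢0)
... | no b≢0 | no p≢0 =
  ℕ.+-mono-≤ (square-mono-≤ (1≤∣i∣ p≢0)) (ℕ.*-monoʳ-≤ 3 (square-mono-≤ (1≤∣i∣ b≢0)))
... | no b≢0 | yes p≡0 =
  ℕ.≤-trans (ℕ.m≤n+m 4 8)
    (ℕ.≤-trans (ℕ.*-monoʳ-≤ 3 (square-mono-≤ 2≤∣b∣)) (quadForm-lowerBoundʳ 3 (+ 2 * a + b , b)))
  where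
  b≡-2a : b ≡ - (+ 2 * a)
  b≡-2a = inverseʳ-unique (+ 2 * a) b p≡0
  a≢0 : a ≢ + 0
  a≢0 refl = b≢0 b≡-2a
  2≤∣b∣ : 2 ℕ.≤ ∣ b ∣
  2≤∣b∣ = subst (2 ℕ.≤_) (trans (sym (ℤ.∣-i∣≡∣i∣ (+ 2 * a))) (cong ∣_∣ (sym b≡-2a))) (2≤∣2*i∣ a≢0)

lemma2p3 : (D : ℤ) → Squarefree D → ¬ (D ≡ + 1) →
    (WellRounded D → (D ≡ - (+ 1)) ⊎ (D ≡ - (+ 3))) ×
    ((D ≡ - (+ 1)) ⊎ (D ≡ - (+ 3)) → WellRounded D)
lemma2p3 D sf D≢1 = wellRounded⇒≡-1⊎≡-3 D (squarefree⇒≢0 sf) D≢1 , wellRounded-if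
  where
  wellRounded-if : D ≡ - + 1 ⊎ D ≡ - + 3 → WellRounded D
  wellRounded-if (inj₁ refl) = wellRounded-if-1-ω-shortest D (+ 4)
    (normSq4-lowerBound D 4 4≤quadForm-gaussian) refl refl
  wellRounded-if (inj₂ refl) = wellRounded-if-1-ω-shortest D (+ 4)
    (normSq4-lowerBound D 4 4≤quadForm-eisenstein) refl refl
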